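{- Let $G$ be a graph, let $T$ be a tree decomposition of $G$ and let $P$ be a weak path decomposition of $G$ such that $T$ and $P$ are $k$-orthogonal and $P$ has magnitude $s$. Then $\operatorname{tw}(G)\le 2\sqrt{ks}-1$.
   Context: A tree decomposition of a graph $G$ is a tree $T$ with bags $T_x\subseteq V(G)$ ($x\in V(T)$) such that every edge of $G$ has both ends in some bag and for each vertex $v$ the nodes whose bags contain $v$ induce a non-empty connected subtree of $T$; its width is $\max_x|T_x|-1$, and $\operatorname{tw}(G)$ is the minimum width of a tree decomposition of $G$. A weak path decomposition of $G$ is a sequence $P_1,\dots,P_t$ of subsets of $V(G)$ with union $V(G)$, such that for every vertex $v$ the bags containing $v$ are consecutive, and for every edge $vw$ both $v,w$ lie in $P_i\cup P_{i+1}$ for some $i\in\{1,\dots,t\}$ (with $P_{t+1}=\emptyset$). Its magnitude is $\sum_i|P_i|$. $T$ and $P$ are $k$-orthogonal if $|T_x\cap P_i|\le k$ for all $x\in V(T)$ and all $i$. -}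

module Defs where

open import Data.Nat as ℕ using (ℕ; zero; suc; _+_; _*_; _<?_)
open import Data.Fin as Fin using (Fin; toℕ; fromℕ<)
open import Data.Fin.Subset using (Subset; _∈_; _∩_; _∪_; ∣_∣; ⊥)
open import Data.List using (map; allFin)
open import Data.Nat.ListAction using (sum)
open import Data.Unit using (⊤)
open import Data.Product using (Σ; ∃; ∃-syntax; _×_; _,_)
open import Relation.Binary.PropositionalEquality using (_≡_)
open import Relation.Nullary using (¬_; yes; no)
open import Function.Definitions using (Injective)

record Graph : Set₁ where
  field
    n      : ℕ
    Adj    : Fin n → Fin n → Set
    sym    : ∀ {u v} → Adj u v → Adj v u
    irrefl : ∀ {v} → ¬ Adj v v

data WalkIn {m : ℕ} (E : Fin m → Fin m → Set) (S : Fin m → Set)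
     : Fin m → Fin m → Set where
  here : ∀ {x} → S x → WalkIn E S x x
  step : ∀ {x y z} → S x → E x y → WalkIn E S y z → WalkIn E S x z

AnyNode : {m : ℕ} → Fin m → Set
AnyNode _ = ⊤

next : ∀ {l} → Fin (suc l) → Fin (suc l)
next {l} i with suc (toℕ i) <? suc l
... | yes p = fromℕ< p
... | no _  = Fin.zero

record Tree : Set₁ where
  field
    m         : ℕ
    nonEmpty  : Fin m
    E         : Fin m → Fin m → Set
    sym       : ∀ {x y} → E x y → E y x
    irrefl    : ∀ {x} → ¬ E x x
    connected : ∀ x y → WalkIn E AnyNode x y
    acyclic   : ∀ (l : ℕ) (c : Fin (3 + l) → Fin m) →
                Injective _≡_ _≡_ c → ¬ (∀ i → E (c i) (c (next i)))

record TreeDecomposition (G : Graph) : Set₁ where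
  open Graph G
  field
    tree : Tree
  open Tree tree public using (m; E)
  field
    bag       : Fin m → Subset n
    edgeCover : ∀ u v → Adj u v → ∃[ x ] (u ∈ bag x × v ∈ bag x)
    nonEmptyOcc : ∀ v → ∃[ x ] (v ∈ bag x)
    connectedOcc : ∀ v x y → v ∈ bag x → v ∈ bag y →
                   WalkIn E (λ z → v ∈ bag z) x y

-- "width ≤ b - 1": every bag has at most b vertices
-- (width = max |T_x| - 1, so width ≤ b - 1 iff all |T_x| ≤ b)
BagsAtMost : ∀ {G} → TreeDecomposition G → ℕ → Set
BagsAtMost D b = ∀ x → ∣ TreeDecomposition.bag D x ∣ ℕ.≤ b

-- a family P : Fin t → Subset n extended by ∅ beyond index t
-- (0-based: extend P j = P_{j+1}, and extend t = P_{t+1} = ∅)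
extend : ∀ {n t} → (Fin t → Subset n) → ℕ → Subset n
extend {t = t} P j with j <? t
... | yes p = P (fromℕ< p)
... | no _  = ⊥

record WeakPathDecomposition (G : Graph) : Set where
  open Graph G
  field
    t     : ℕ
    P     : Fin t → Subset n
  field
    cover       : ∀ v → ∃[ i ] (v ∈ P i)
    consecutive : ∀ v (i j l : Fin t) → v ∈ P i → v ∈ P j →
                  i Fin.≤ l → l Fin.≤ j → v ∈ P l
    edgeCover   : ∀ u v → Adj u v →
                  ∃[ i ] (u ∈ (P i ∪ extend P (suc (toℕ i))) ×
                          v ∈ (P i ∪ extend P (suc (toℕ i))))

magnitude : ∀ {G} → WeakPathDecomposition G → ℕ
magnitude W = sum (map (λ i → ∣ P i ∣) (allFin t))
  where open WeakPathDecomposition W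

Orthogonal : ∀ {G} → ℕ → TreeDecomposition G → WeakPathDecomposition G → Set
Orthogonal k D W =
  ∀ x i → ∣ TreeDecomposition.bag D x ∩ WeakPathDecomposition.P W i ∣ ℕ.≤ k

-- Choose a with k·a² ≤ s ≤ k·(a+1)² and let r = a + 1. Split the indices of P into the r
-- residue classes modulo r; the bags of some class have total size q ≤ s/r. Their union X cuts
-- P into windows of a consecutive bags, and every vertex and every edge of G - X lies within a
-- single window. Take one copy of T for each window w, with bags X ∪ (T_x ∩ ⋃ window w), and
-- join the copies to a hub with bag X. This is a tree decomposition of G whose bags have size at
-- most q + a·k by orthogonality, and (q + a·k)² ≤ 4ks.

module Submission where

open import Data.Nat using (ℕ; zero; suc; _+_; _*_; _∸_; _≤_; _<_; _≤?_; _<?_; z≤n; s≤s; NonZero)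
open import Data.Nat.Properties
open import Data.Nat.DivMod
  using (_%_; _/_; m<n⇒m%n≡m; [m+n]%n≡m%n; [m+kn]%n≡m%n; m%n<n; m≤n⇒[n∸m]%m≡n%m; m≡m%n+[m/n]*n; n%n≡0;
         m*n%n≡0; m*n/n≡m; m<n⇒m/n≡0; m/n≤m; /-monoˡ-≤; +-distrib-/-∣ˡ)
open import Data.Nat.Divisibility using (n∣m*n)
open import Data.Nat.Tactic.RingSolver using (solve-∀)
open import Data.Fin as Fin using (Fin; zero; suc; toℕ; fromℕ<)
import Data.Fin.Properties as Fin
open import Data.Fin.Subset using (Subset; Empty; _∈_; _∉_; _⊆_; _∩_; _∪_; ∣_∣; ⊥; ⁅_⁆; ⋃; inside; outside)
open import Data.Fin.Subset.Properties
  using (_∈?_; Empty-unique; ∣p∣≤∣x∷p∣; ∣⊥∣≡0; ∉⊥; x∈p∪q⁺; x∈p∪q⁻; x∈p∩q⁺; x∈p∩q⁻; ∣p∩q∣≤∣q∣; ∩-distribˡ-∪;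
         p⊆q⇒∣p∣≤∣q∣; ∣⁅x⁆∣≡1; x∈⁅y⁆⇒x≡y)
open import Data.Vec using (_∷_; [])
open import Data.Sum as Sum using (_⊎_; inj₁; inj₂)
open import Data.List using (tabulate)
import Data.List as List
import Data.Nat.ListAction as ℕ
open import Algebra.Properties.CommutativeMonoid.Sum +-0-commutativeMonoid
  using (sum-syntax; sum-cong-≗; sum-replicate-zero; ∑-comm)
open import Function using (_∘_; id)
open import Data.Product using (∃-syntax; _×_; _,_; proj₁; proj₂; uncurry)
open import Data.Empty using () renaming (⊥ to ⊥₀)
open import Data.Unit using (tt)
open import Function.Definitions using (Injective)
open import Relation.Binary.PropositionalEquality
  using (_≡_; _≢_; refl; sym; trans; cong; cong₂; subst; subst₂; module ≡-Reasoning)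
open import Relation.Nullary using (¬_; yes; no; contradiction)

open import Defs

∃-bracket : (f : ℕ → ℕ) {s : ℕ} → f 0 ≤ s → ∀ N → s ≤ f (suc N) →
            ∃[ a ] (f a ≤ s × s ≤ f (suc a))
∃-bracket f f0≤s zero s≤f1 = 0 , f0≤s , s≤f1
∃-bracket f f0≤s (suc N) s≤f with _ ≤? f (suc N)
... | yes s≤fN = ∃-bracket f f0≤s N s≤fN
... | no  s≰fN = suc N , <⇒≤ (≰⇒> s≰fN) , s≤f

∃-sqrt-bracket : ∀ k s → .{{_ : NonZero k}} → ∃[ a ] (k * (a * a) ≤ s × s ≤ k * (suc a * suc a))
∃-sqrt-bracket k s = ∃-bracket (λ a → k * (a * a)) (≤-trans (≤-reflexive (*-zeroʳ k)) z≤n) s (begin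
  s                     ≤⟨ m≤m*n s (suc s) ⟩
  s * suc s             ≤⟨ m≤n+m (s * suc s) (suc s) ⟩
  suc s * suc s         ≤⟨ m≤n*m (suc s * suc s) k ⟩
  k * (suc s * suc s)   ∎)
  where open ≤-Reasoning

-- 4ksr² - (s + akr)² = (s - ka²)(kr² - s) + k(4a+3)s for r = a + 1, written for s = ka² + u
-- (so kr² - s = k(2a+1) - u) with both sides moved so that no subtraction occurs.
square-identity : ∀ a k u →
  (k * (a * a) + u + a * k * suc a) * (k * (a * a) + u + a * k * suc a)
    + u * (k * (2 * a + 1)) + k * (4 * a + 3) * (k * (a * a) + u)
  ≡ 4 * k * (k * (a * a) + u) * (suc a * suc a) + u * u
square-identity = solve-∀

[s+akr]²≤4ksr² : ∀ a k s → k * (a * a) ≤ s → s ≤ k * (suc a * suc a) →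
               (s + a * k * suc a) * (s + a * k * suc a) ≤ 4 * k * s * (suc a * suc a)
[s+akr]²≤4ksr² a k s lo hi =
  subst (λ s → (s + a * k * suc a) * (s + a * k * suc a) ≤ 4 * k * s * (suc a * suc a))
        (m+[n∸m]≡n lo) (bound (s ∸ k * (a * a)) u≤K)
  where
  K : ℕ
  K = k * (2 * a + 1)
  u≤K : s ∸ k * (a * a) ≤ K
  u≤K = +-cancelˡ-≤ (k * (a * a)) _ _ (begin
    k * (a * a) + (s ∸ k * (a * a)) ≡⟨ m+[n∸m]≡n lo ⟩
    s                               ≤⟨ hi ⟩
    k * (suc a * suc a)             ≡⟨ expand a k ⟩
    k * (a * a) + K                 ∎)
    where
    open ≤-Reasoning
    expand : ∀ a k → k * (suc a * suc a) ≡ k * (a * a) + k * (2 * a + 1)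
    expand = solve-∀
  bound : ∀ u → u ≤ K → let s = k * (a * a) + u in
          (s + a * k * suc a) * (s + a * k * suc a) ≤ 4 * k * s * (suc a * suc a)
  bound u u≤K = +-cancelʳ-≤ (u * K) _ _ (begin
    S * S + u * K                             ≤⟨ m≤m+n (S * S + u * K) _ ⟩
    S * S + u * K + k * (4 * a + 3) * s′      ≡⟨ square-identity a k u ⟩
    4 * k * s′ * (suc a * suc a) + u * u      ≤⟨ +-monoʳ-≤ _ (*-monoʳ-≤ u u≤K) ⟩
    4 * k * s′ * (suc a * suc a) + u * K      ∎)
    where
    open ≤-Reasoning
    s′ S : ℕ
    s′ = k * (a * a) + u
    S = s′ + a * k * suc a

[q+ak]²≤4ks : ∀ a k s q → k * (a * a) ≤ s → s ≤ k * (suc a * suc a) → suc a * q ≤ s →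
             (q + a * k) * (q + a * k) ≤ 4 * k * s
[q+ak]²≤4ks a k s q lo hi rq≤s = *-cancelʳ-≤ _ _ (suc a * suc a) (begin
  B * B * (suc a * suc a)                 ≡⟨ regroup B (suc a) ⟩
  (B * suc a) * (B * suc a)               ≤⟨ *-mono-≤ Br≤ Br≤ ⟩
  (s + a * k * suc a) * (s + a * k * suc a) ≤⟨ [s+akr]²≤4ksr² a k s lo hi ⟩
  4 * k * s * (suc a * suc a)             ∎)
  where
  open ≤-Reasoning
  B : ℕ
  B = q + a * k
  regroup : ∀ b r → b * b * (r * r) ≡ (b * r) * (b * r)
  regroup = solve-∀
  Br≤ : B * suc a ≤ s + a * k * suc a
  Br≤ = begin
    (q + a * k) * suc a           ≡⟨ *-distribʳ-+ (suc a) q (a * k) ⟩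
    q * suc a + a * k * suc a     ≤⟨ +-monoˡ-≤ (a * k * suc a) (≤-trans (≤-reflexive (*-comm q (suc a))) rq≤s) ⟩
    s + a * k * suc a             ∎

sum-map-tabulate : ∀ {t} {A : Set} (f : A → ℕ) (g : Fin t → A) →
                   ℕ.sum (List.map f (tabulate g)) ≡ ∑[ i < t ] f (g i)
sum-map-tabulate {zero}  f g = refl
sum-map-tabulate {suc t} f g = cong (f (g zero) +_) (sum-map-tabulate f (g ∘ suc))

∑-≤-* : ∀ {N} c (f : Fin N → ℕ) → (∀ i → f i ≤ c) → ∑[ i < N ] f i ≤ N * c
∑-≤-* {zero}  c f f≤c = z≤n
∑-≤-* {suc N} c f f≤c = +-mono-≤ (f≤c zero) (∑-≤-* c (f ∘ suc) (f≤c ∘ suc))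

*-≤-∑ : ∀ {N} c (f : Fin N → ℕ) → (∀ i → c ≤ f i) → N * c ≤ ∑[ i < N ] f i
*-≤-∑ {zero}  c f c≤f = z≤n
*-≤-∑ {suc N} c f c≤f = +-mono-≤ (c≤f zero) (*-≤-∑ c (f ∘ suc) (c≤f ∘ suc))

∃-minimum : ∀ {N} (f : Fin (suc N) → ℕ) → ∃[ i ] (∀ j → f i ≤ f j)
∃-minimum {zero} f = zero , λ { zero → ≤-refl }
∃-minimum {suc N} f with ∃-minimum (f ∘ suc)
... | i , min with f zero ≤? f (suc i)
...   | yes f0≤ = zero , λ { zero → ≤-refl ; (suc j) → ≤-trans f0≤ (min j) }
...   | no  f0≰ = suc i , λ { zero → <⇒≤ (≰⇒> f0≰) ; (suc j) → min j }

∃-≤-average : ∀ {N} (f : Fin (suc N) → ℕ) → ∃[ i ] (suc N * f i ≤ ∑[ j < suc N ] f j)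
∃-≤-average f with ∃-minimum f
... | i , min = i , *-≤-∑ (f i) f min

∑-shift : ∀ N (g : ℕ → ℕ) → g N ≡ g 0 → ∑[ D < N ] g (suc (toℕ D)) ≡ ∑[ D < N ] g (toℕ D)
∑-shift N g gN≡g0 = +-cancelʳ-≡ (g 0) _ _ (trans (shift N g) (cong (∑[ D < N ] g (toℕ D) +_) gN≡g0))
  where
  shift : ∀ N (g : ℕ → ℕ) → ∑[ D < N ] g (suc (toℕ D)) + g 0 ≡ ∑[ D < N ] g (toℕ D) + g N
  shift zero    g = refl
  shift (suc N) g = begin
    g 1 + A + g 0             ≡⟨ cong (_+ g 0) (+-comm (g 1) A) ⟩
    A + g 1 + g 0             ≡⟨ cong (_+ g 0) (shift N (g ∘ suc)) ⟩
    B + g (suc N) + g 0       ≡⟨ +-comm (B + g (suc N)) (g 0) ⟩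
    g 0 + (B + g (suc N))     ≡⟨ +-assoc (g 0) B (g (suc N)) ⟨
    g 0 + B + g (suc N)       ∎
    where
    open ≡-Reasoning
    A B : ℕ
    A = ∑[ D < N ] g (suc (suc (toℕ D)))
    B = ∑[ D < N ] g (suc (toℕ D))

∑-rotate : ∀ r .{{_ : NonZero r}} (h : ℕ → ℕ) j →
           ∑[ D < r ] h ((j + toℕ D) % r) ≡ ∑[ D < r ] h (toℕ D)
∑-rotate r h zero    = sum-cong-≗ (λ D → cong h (m<n⇒m%n≡m (Fin.toℕ<n D)))
∑-rotate r h (suc j) = begin
  ∑[ D < r ] h ((suc j + toℕ D) % r)  ≡⟨ sum-cong-≗ {r} (λ D → cong (λ e → h (e % r)) (+-suc j (toℕ D))) ⟨
  ∑[ D < r ] g (suc (toℕ D))          ≡⟨ ∑-shift r g periodic ⟩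
  ∑[ D < r ] g (toℕ D)                ≡⟨ ∑-rotate r h j ⟩
  ∑[ D < r ] h (toℕ D)                ∎
  where
  open ≡-Reasoning
  g : ℕ → ℕ
  g e = h ((j + e) % r)
  periodic : g r ≡ g 0
  periodic = cong h (trans ([m+n]%n≡m%n j r) (cong (_% r) (sym (+-identityʳ j))))

∣p∪q∣≤∣p∣+∣q∣ : ∀ {n} (p q : Subset n) → ∣ p ∪ q ∣ ≤ ∣ p ∣ + ∣ q ∣
∣p∪q∣≤∣p∣+∣q∣ []            []            = z≤n
∣p∪q∣≤∣p∣+∣q∣ (inside  ∷ p) (x ∷ q)       =
  s≤s (≤-trans (∣p∪q∣≤∣p∣+∣q∣ p q) (+-monoʳ-≤ ∣ p ∣ (∣p∣≤∣x∷p∣ x q)))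
∣p∪q∣≤∣p∣+∣q∣ (outside ∷ p) (inside  ∷ q) =
  ≤-trans (s≤s (∣p∪q∣≤∣p∣+∣q∣ p q)) (≤-reflexive (sym (+-suc ∣ p ∣ ∣ q ∣)))
∣p∪q∣≤∣p∣+∣q∣ (outside ∷ p) (outside ∷ q) = ∣p∪q∣≤∣p∣+∣q∣ p q

x∈p⇒0<∣p∣ : ∀ {n} {x : Fin n} {p : Subset n} → x ∈ p → 0 < ∣ p ∣
x∈p⇒0<∣p∣ {x = x} {p} x∈p = ≤-trans (≤-reflexive (sym (∣⁅x⁆∣≡1 x))) (p⊆q⇒∣p∣≤∣q∣ ⁅x⁆⊆p)
  where
  ⁅x⁆⊆p : ⁅ x ⁆ ⊆ p
  ⁅x⁆⊆p y∈⁅x⁆ = subst (_∈ p) (sym (x∈⁅y⁆⇒x≡y x y∈⁅x⁆)) x∈p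

module _ {n : ℕ} where

  x∈⋃tabulate⁺ : ∀ {N} (f : Fin N → Subset n) {x} i → x ∈ f i → x ∈ ⋃ (tabulate f)
  x∈⋃tabulate⁺ f zero    x∈fi = x∈p∪q⁺ (inj₁ x∈fi)
  x∈⋃tabulate⁺ f (suc i) x∈fi = x∈p∪q⁺ {p = f zero} (inj₂ (x∈⋃tabulate⁺ (f ∘ suc) i x∈fi))

  x∈⋃tabulate⁻ : ∀ {N} (f : Fin N → Subset n) {x} → x ∈ ⋃ (tabulate f) → ∃[ i ] (x ∈ f i)
  x∈⋃tabulate⁻ {zero}  f x∈⊥ = contradiction x∈⊥ ∉⊥
  x∈⋃tabulate⁻ {suc N} f x∈∪ with x∈p∪q⁻ (f zero) _ x∈∪
  ... | inj₁ x∈f0 = zero , x∈f0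
  ... | inj₂ x∈⋃  with x∈⋃tabulate⁻ (f ∘ suc) x∈⋃
  ...   | i , x∈fi = suc i , x∈fi

  ∣⋃tabulate∣≤∑ : ∀ {N} (f : Fin N → Subset n) → ∣ ⋃ (tabulate f) ∣ ≤ ∑[ i < N ] ∣ f i ∣
  ∣⋃tabulate∣≤∑ {zero}  f = ≤-reflexive (∣⊥∣≡0 n)
  ∣⋃tabulate∣≤∑ {suc N} f =
    ≤-trans (∣p∪q∣≤∣p∣+∣q∣ (f zero) _) (+-monoʳ-≤ ∣ f zero ∣ (∣⋃tabulate∣≤∑ (f ∘ suc)))

  ∣p∩⋃tabulate∣≤∑ : ∀ {N} (p : Subset n) (f : Fin N → Subset n) →
                    ∣ p ∩ ⋃ (tabulate f) ∣ ≤ ∑[ i < N ] ∣ p ∩ f i ∣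
  ∣p∩⋃tabulate∣≤∑ {zero}  p f = ≤-trans (∣p∩q∣≤∣q∣ p ⊥) (≤-reflexive (∣⊥∣≡0 n))
  ∣p∩⋃tabulate∣≤∑ {suc N} p f = begin
    ∣ p ∩ (f zero ∪ ⋃ (tabulate (f ∘ suc))) ∣         ≡⟨ cong ∣_∣ (∩-distribˡ-∪ p (f zero) _) ⟩
    ∣ (p ∩ f zero) ∪ (p ∩ ⋃ (tabulate (f ∘ suc))) ∣   ≤⟨ ∣p∪q∣≤∣p∣+∣q∣ (p ∩ f zero) _ ⟩
    ∣ p ∩ f zero ∣ + ∣ p ∩ ⋃ (tabulate (f ∘ suc)) ∣   ≤⟨ +-monoʳ-≤ _ (∣p∩⋃tabulate∣≤∑ p (f ∘ suc)) ⟩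
    ∑[ i < suc N ] ∣ p ∩ f i ∣                        ∎
    where open ≤-Reasoning

atZero : ∀ {n} → ℕ → Subset n → Subset n
atZero zero    p = p
atZero (suc _) p = ⊥

∑-atZero-rotate : ∀ {n} a j (p : Subset n) →
                  ∑[ D < suc a ] ∣ atZero ((j + toℕ D) % suc a) p ∣ ≡ ∣ p ∣
∑-atZero-rotate {n} a j p = begin
  ∑[ D < suc a ] ∣ atZero ((j + toℕ D) % suc a) p ∣   ≡⟨ ∑-rotate (suc a) (λ e → ∣ atZero e p ∣) j ⟩
  ∣ p ∣ + ∑[ D < a ] ∣ ⊥ {n} ∣                         ≡⟨ cong (∣ p ∣ +_) (sum-cong-≗ {a} (λ _ → ∣⊥∣≡0 n)) ⟩
  ∣ p ∣ + ∑[ D < a ] 0                                 ≡⟨ cong (∣ p ∣ +_) (sum-replicate-zero a) ⟩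
  ∣ p ∣ + 0                                            ≡⟨ +-identityʳ ∣ p ∣ ⟩
  ∣ p ∣                                                ∎
  where open ≡-Reasoning

residue-class-size : ∀ {n t} a → ℕ → (Fin t → Subset n) → ℕ
residue-class-size {t = t} a D p = ∑[ i < t ] ∣ atZero ((toℕ i + D) % suc a) (p i) ∣

∃-light-residue-class : ∀ {n t} a (p : Fin t → Subset n) →
                        ∃[ D ] (D < suc a × suc a * residue-class-size a D p ≤ ∑[ i < t ] ∣ p i ∣)
∃-light-residue-class {t = t} a p with ∃-≤-average (λ D → residue-class-size a (toℕ D) p)
... | D , avg = toℕ D , Fin.toℕ<n D , ≤-trans avg (≤-reflexive (begin
  ∑[ D < suc a ] ∑[ i < t ] class D i   ≡⟨ ∑-comm {suc a} {t} class ⟩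
  ∑[ i < t ] ∑[ D < suc a ] class D i   ≡⟨ sum-cong-≗ (λ i → ∑-atZero-rotate a (toℕ i) (p i)) ⟩
  ∑[ i < t ] ∣ p i ∣                    ∎))
  where
  open ≡-Reasoning
  class : Fin (suc a) → Fin t → ℕ
  class D i = ∣ atZero ((toℕ i + toℕ D) % suc a) (p i) ∣

module Walk where

  map : ∀ {m m′} {E : Fin m → Fin m → Set} {S : Fin m → Set}
          {E′ : Fin m′ → Fin m′ → Set} {S′ : Fin m′ → Set} (f : Fin m → Fin m′) →
        (∀ {x y} → E x y → E′ (f x) (f y)) → (∀ {x} → S x → S′ (f x)) →
        ∀ {x y} → WalkIn E S x y → WalkIn E′ S′ (f x) (f y)
  map f fE fS (here s)     = here (fS s)
  map f fE fS (step s e w) = step (fS s) (fE e) (map f fE fS w)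

  module _ {m} {E : Fin m → Fin m → Set} {S : Fin m → Set} where

    _++_ : ∀ {x y z} → WalkIn E S x y → WalkIn E S y z → WalkIn E S x z
    here _     ++ w′ = w′
    step s e w ++ w′ = step s e (w ++ w′)

    start : ∀ {x y} → WalkIn E S x y → S x
    start (here s)     = s
    start (step s _ _) = s

    reverse : (∀ {x y} → E x y → E y x) → ∀ {x y} → WalkIn E S x y → WalkIn E S y x
    reverse E-sym (here s)     = here s
    reverse E-sym (step s e w) = reverse E-sym w ++ step (start w) (E-sym e) (here s)

[m+d]%n≢m : ∀ {m d n} .{{_ : NonZero n}} → m < n → 0 < d → d < n → (m + d) % n ≢ m
[m+d]%n≢m {m} {d} {n} m<n 0<d d<n eq with m + d <? n
... | yes m+d<n = <⇒≢ (m<m+n m 0<d) (sym (trans (sym (m<n⇒m%n≡m m+d<n)) eq))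
... | no  m+d≮n = <⇒≢ d<n (+-cancelˡ-≡ m _ _ (begin
  m + d            ≡⟨ m∸n+n≡m n≤m+d ⟨
  m + d ∸ n + n    ≡⟨ cong (_+ n) wrapped ⟩
  m + n            ∎))
  where
  open ≡-Reasoning
  n≤m+d : n ≤ m + d
  n≤m+d = ≮⇒≥ m+d≮n
  reduced : m + d ∸ n < n
  reduced = <-trans (≤-trans (∸-monoˡ-< (+-monoʳ-< m d<n) n≤m+d) (≤-reflexive (m+n∸n≡m m n))) m<n
  wrapped : m + d ∸ n ≡ m
  wrapped = trans (sym (m<n⇒m%n≡m reduced)) (trans (m≤n⇒[n∸m]%m≡n%m n≤m+d) eq)

suc-%-absorb : ∀ x n .{{_ : NonZero n}} → suc (x % n) % n ≡ suc x % n
suc-%-absorb x n = begin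
  suc (x % n) % n                 ≡⟨ [m+kn]%n≡m%n (suc (x % n)) (x / n) n ⟨
  (suc (x % n) + x / n * n) % n   ≡⟨ cong (λ y → suc y % n) (m≡m%n+[m/n]*n x n) ⟨
  suc x % n                       ∎
  where open ≡-Reasoning

module _ {l : ℕ} where

  next^ : ℕ → Fin (suc l) → Fin (suc l)
  next^ zero    i = i
  next^ (suc d) i = next (next^ d i)

  toℕ-next : (i : Fin (suc l)) → toℕ (next i) ≡ suc (toℕ i) % suc l
  toℕ-next i with suc (toℕ i) <? suc l
  ... | yes i+1<L = trans (Fin.toℕ-fromℕ< i+1<L) (sym (m<n⇒m%n≡m i+1<L))
  ... | no  i+1≮L = sym (trans (cong (_% suc l) i+1≡L) (n%n≡0 (suc l)))
    where
    i+1≡L : suc (toℕ i) ≡ suc l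
    i+1≡L = ≤-antisym (Fin.toℕ<n i) (≮⇒≥ i+1≮L)

  toℕ-next^ : ∀ d (i : Fin (suc l)) → toℕ (next^ d i) ≡ (toℕ i + d) % suc l
  toℕ-next^ zero    i = sym (trans (cong (_% suc l) (+-identityʳ (toℕ i))) (m<n⇒m%n≡m (Fin.toℕ<n i)))
  toℕ-next^ (suc d) i = begin
    toℕ (next (next^ d i))          ≡⟨ toℕ-next (next^ d i) ⟩
    suc (toℕ (next^ d i)) % suc l   ≡⟨ cong (λ x → suc x % suc l) (toℕ-next^ d i) ⟩
    suc ((toℕ i + d) % suc l) % suc l ≡⟨ suc-%-absorb (toℕ i + d) (suc l) ⟩
    suc (toℕ i + d) % suc l         ≡⟨ cong (_% suc l) (+-suc (toℕ i) d) ⟨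
    (toℕ i + suc d) % suc l         ∎
    where open ≡-Reasoning

  next^-next : ∀ d (i : Fin (suc l)) → next^ d (next i) ≡ next^ (suc d) i
  next^-next zero    i = refl
  next^-next (suc d) i = cong next (next^-next d i)

  next^-period : (i : Fin (suc l)) → next^ (suc l) i ≡ i
  next^-period i = Fin.toℕ-injective (begin
    toℕ (next^ (suc l) i)       ≡⟨ toℕ-next^ (suc l) i ⟩
    (toℕ i + suc l) % suc l     ≡⟨ [m+n]%n≡m%n (toℕ i) (suc l) ⟩
    toℕ i % suc l               ≡⟨ m<n⇒m%n≡m (Fin.toℕ<n i) ⟩
    toℕ i                       ∎)
    where open ≡-Reasoning

  next^-from-zero : (i : Fin (suc l)) → next^ (toℕ i) zero ≡ i
  next^-from-zero i = Fin.toℕ-injective (trans (toℕ-next^ (toℕ i) zero) (m<n⇒m%n≡m (Fin.toℕ<n i)))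

  next^-≢ : ∀ {d} → 0 < d → d < suc l → (i : Fin (suc l)) → next^ d i ≢ i
  next^-≢ {d} 0<d d<L i eq =
    [m+d]%n≢m (Fin.toℕ<n i) 0<d d<L (trans (sym (toℕ-next^ d i)) (cong toℕ eq))

-- A hub joined to the root of each of R copies of T

module Star (T : Tree) (R : ℕ) where

  open Tree T using (m; E) renaming (nonEmpty to root)

  Node : Set
  Node = Fin (suc (R * m))

  hub : Node
  hub = zero

  copy : Fin R → Fin m → Node
  copy w x = suc (Fin.combine w x)

  decode : Fin (R * m) → Fin R × Fin m
  decode = Fin.remQuot {R} m

  decode-combine : ∀ w x → decode (Fin.combine w x) ≡ (w , x)
  decode-combine = Fin.remQuot-combine

  layer : Node → ℕ
  layer zero    = 0
  layer (suc y) = suc (toℕ (proj₁ (decode y)))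

  spot : Node → Fin m
  spot zero    = root
  spot (suc y) = proj₂ (decode y)

  Edge : Node → Node → Set
  Edge zero    zero     = ⊥₀
  Edge zero    (suc y)  = spot (suc y) ≡ root
  Edge (suc y) zero     = spot (suc y) ≡ root
  Edge (suc y) (suc y′) = layer (suc y) ≡ layer (suc y′) × E (spot (suc y)) (spot (suc y′))

  data View : Node → Set where
    hub-view  : View hub
    copy-view : ∀ w x → View (copy w x)

  view : ∀ z → View z
  view zero    = hub-view
  view (suc y) = subst View (cong suc (Fin.combine-remQuot {R} m y)) (uncurry copy-view (decode y))

  layer-copy : ∀ w x → layer (copy w x) ≡ suc (toℕ w)
  layer-copy w x = cong (suc ∘ toℕ ∘ proj₁) (decode-combine w x)

  spot-copy : ∀ w x → spot (copy w x) ≡ x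
  spot-copy w x = cong proj₂ (decode-combine w x)

  layer-spot-injective : ∀ {z z′} → layer z ≡ layer z′ → spot z ≡ spot z′ → z ≡ z′
  layer-spot-injective {zero}  {zero}   _ _ = refl
  layer-spot-injective {suc y} {suc y′} same-layer same-spot = cong suc (begin
    y                               ≡⟨ Fin.combine-remQuot {R} m y ⟨
    uncurry Fin.combine (decode y)  ≡⟨ cong₂ Fin.combine (Fin.toℕ-injective (suc-injective same-layer))
                                                         same-spot ⟩
    uncurry Fin.combine (decode y′) ≡⟨ Fin.combine-remQuot {R} m y′ ⟩
    y′                              ∎)
    where open ≡-Reasoning

  Edge-sym : ∀ {z z′} → Edge z z′ → Edge z′ z
  Edge-sym {zero}  {suc _}  e         = e
  Edge-sym {suc _} {zero}   e         = e
  Edge-sym {suc _} {suc _}  (eℓ , e)  = sym eℓ , Tree.sym T e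

  Edge-irrefl : ∀ {z} → ¬ Edge z z
  Edge-irrefl {suc _} (_ , e) = Tree.irrefl T e

  copy-edge : ∀ w {x y} → E x y → Edge (copy w x) (copy w y)
  copy-edge w {x} {y} e =
    trans (layer-copy w x) (sym (layer-copy w y)) , subst₂ E (sym (spot-copy w x)) (sym (spot-copy w y)) e

  spoke : ∀ w → Edge (copy w root) hub
  spoke w = spot-copy w root

  inner-edge : ∀ {z z′} → z ≢ hub → z′ ≢ hub → Edge z z′ → layer z ≡ layer z′ × E (spot z) (spot z′)
  inner-edge {zero}           z≢hub _      _ = contradiction refl z≢hub
  inner-edge {suc _} {zero}   _     z′≢hub _ = contradiction refl z′≢hub
  inner-edge {suc _} {suc _}  _     _      e = e

  spoke-root : ∀ {z} → Edge hub z → spot z ≡ root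
  spoke-root {suc _} e = e

  to-hub : ∀ z → WalkIn Edge AnyNode z hub
  to-hub z with view z
  ... | hub-view      = here tt
  ... | copy-view w x = Walk.map (copy w) (copy-edge w) (λ _ → tt) (Tree.connected T x root)
                          Walk.++ step tt (spoke w) (here tt)

  connected : ∀ z z′ → WalkIn Edge AnyNode z z′
  connected z z′ = to-hub z Walk.++ Walk.reverse Edge-sym (to-hub z′)

  -- A cycle avoiding the hub stays in one layer and projects to a cycle of T. A cycle through
  -- the hub returns to it along a hub-free arc, which stays in one copy and starts and ends at
  -- that copy's root, so the cycle would repeat a node.
  module _ (l : ℕ) (c : Fin (3 + l) → Node) (c-inj : Injective _≡_ _≡_ c)
           (cycle : ∀ i → Edge (c i) (c (next i))) where

    arc-layer : ∀ i d → (∀ e → e ≤ d → c (next^ e i) ≢ hub) → layer (c (next^ d i)) ≡ layer (c i)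
    arc-layer i zero    off = refl
    arc-layer i (suc d) off = trans (sym same-step) (arc-layer i d (λ e e≤d → off e (m≤n⇒m≤1+n e≤d)))
      where
      same-step : layer (c (next^ d i)) ≡ layer (c (next^ (suc d) i))
      same-step = proj₁ (inner-edge (off d (n≤1+n d)) (off (suc d) ≤-refl) (cycle (next^ d i)))

    avoiding-hub : (∀ i → c i ≢ hub) → ⊥₀
    avoiding-hub off =
      Tree.acyclic T l (spot ∘ c) spot∘c-inj (λ i → proj₂ (inner-edge (off i) (off (next i)) (cycle i)))
      where
      layer-c : ∀ i → layer (c i) ≡ layer (c zero)
      layer-c i = subst (λ j → layer (c j) ≡ layer (c zero)) (next^-from-zero i)
                        (arc-layer zero (toℕ i) (λ e _ → off (next^ e zero)))
      spot∘c-inj : Injective _≡_ _≡_ (spot ∘ c)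
      spot∘c-inj {i} {j} eq = c-inj (layer-spot-injective (trans (layer-c i) (sym (layer-c j))) eq)

    through-hub : ∀ p → c p ≡ hub → ⊥₀
    through-hub p cp≡hub =
      next^-≢ (s≤s z≤n) (<-trans (n<1+n (suc l)) (n<1+n (2 + l))) first (c-inj c-last≡c-first)
      where
      first last : Fin (3 + l)
      first = next p
      last  = next^ (suc l) first
      off : ∀ e → e ≤ suc l → c (next^ e first) ≢ hub
      off e e≤ hit = next^-≢ (s≤s z≤n) (s≤s (s≤s e≤)) p
                       (c-inj (trans (cong c (sym (next^-next e p))) (trans hit (sym cp≡hub))))
      last-to-hub : Edge (c last) hub
      last-to-hub = subst (Edge (c last)) cp≡hub (subst (λ j → Edge (c last) (c j))
                          (trans (cong next (next^-next (suc l) p)) (next^-period p)) (cycle last))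
      first-from-hub : Edge hub (c first)
      first-from-hub = subst (λ z → Edge z (c first)) cp≡hub (cycle p)
      c-last≡c-first : c last ≡ c first
      c-last≡c-first = layer-spot-injective (arc-layer first (suc l) off)
        (trans (spoke-root (Edge-sym last-to-hub)) (sym (spoke-root first-from-hub)))

    no-cycle : ⊥₀
    no-cycle with Fin.any? (λ i → c i Fin.≟ hub)
    ... | yes (p , cp≡hub) = through-hub p cp≡hub
    ... | no  no-hub       = avoiding-hub (λ i ci≡hub → no-hub (i , ci≡hub))

  tree : Tree
  tree = record
    { m = suc (R * m) ; nonEmpty = hub ; E = Edge ; sym = Edge-sym ; irrefl = Edge-irrefl
    ; connected = connected ; acyclic = λ l c c-inj cycle → no-cycle l c c-inj cycle }

-- Gluing copies of a tree decomposition

module Glue {G : Graph} (T : TreeDecomposition G) (R : ℕ)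
            (X : Subset (Graph.n G)) (part : Fin R → Subset (Graph.n G))
            (local-cover : ∀ v → ∃[ w ] (v ∈ X ⊎ v ∈ part w))
            (local-edge  : ∀ u v → Graph.Adj G u v → ∃[ w ] ((u ∈ X ⊎ u ∈ part w) × (v ∈ X ⊎ v ∈ part w)))
            (part-unique : ∀ {v w w′} → v ∉ X → v ∈ part w → v ∈ part w′ → w ≡ w′) where

  open Graph G using (n)
  open TreeDecomposition T using (m; bag)
  open Star (TreeDecomposition.tree T) R

  copy-bag : Fin R → Fin m → Subset n
  copy-bag w x = X ∪ (bag x ∩ part w)

  bag′ : Node → Subset n
  bag′ zero    = X
  bag′ (suc y) = uncurry copy-bag (decode y)

  bag′-copy : ∀ w x → bag′ (copy w x) ≡ copy-bag w x
  bag′-copy w x = cong (uncurry copy-bag) (decode-combine w x)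

  ∈-bag′-copy⁺ : ∀ {v w x} → v ∈ X ⊎ v ∈ part w → v ∈ bag x → v ∈ bag′ (copy w x)
  ∈-bag′-copy⁺ {v} {w} {x} v-local v∈x =
    subst (v ∈_) (sym (bag′-copy w x)) (x∈p∪q⁺ (Sum.map₂ (λ v∈w → x∈p∩q⁺ (v∈x , v∈w)) v-local))

  ∈-bag′-copy⁻ : ∀ {v w x} → v ∈ bag′ (copy w x) → v ∈ X ⊎ (v ∈ bag x × v ∈ part w)
  ∈-bag′-copy⁻ {v} {w} {x} v∈ with x∈p∪q⁻ X _ (subst (v ∈_) (bag′-copy w x) v∈)
  ... | inj₁ v∈X = inj₁ v∈X
  ... | inj₂ v∈∩ = inj₂ (x∈p∩q⁻ (bag x) (part w) v∈∩)

  X⊆bag′ : ∀ {v} → v ∈ X → ∀ z → v ∈ bag′ z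
  X⊆bag′ v∈X zero    = v∈X
  X⊆bag′ v∈X (suc y) = x∈p∪q⁺ (inj₁ v∈X)

  connected-occurrences : ∀ v z z′ → v ∈ bag′ z → v ∈ bag′ z′ → WalkIn Edge (λ z → v ∈ bag′ z) z z′
  connected-occurrences v z z′ v∈z v∈z′ with v ∈? X
  ... | yes v∈X = Walk.map id id (λ {z} _ → X⊆bag′ v∈X z) (connected z z′)
  ... | no  v∉X with view z | view z′
  ...   | hub-view      | _              = contradiction v∈z v∉X
  ...   | copy-view _ _ | hub-view       = contradiction v∈z′ v∉X
  ...   | copy-view w x | copy-view w′ x′ with ∈-bag′-copy⁻ v∈z | ∈-bag′-copy⁻ v∈z′
  ...     | inj₁ v∈X         | _                   = contradiction v∈X v∉X
  ...     | inj₂ _           | inj₁ v∈X            = contradiction v∈X v∉X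
  ...     | inj₂ (v∈x , v∈w) | inj₂ (v∈x′ , v∈w′) with refl ← part-unique v∉X v∈w v∈w′ =
    Walk.map (copy w) (copy-edge w) (∈-bag′-copy⁺ (inj₂ v∈w))
             (TreeDecomposition.connectedOcc T v x x′ v∈x v∈x′)

  decomposition : TreeDecomposition G
  decomposition = record
    { tree         = tree
    ; bag          = bag′
    ; edgeCover    = edge-cover
    ; nonEmptyOcc  = occurrence
    ; connectedOcc = connected-occurrences
    }
    where
    edge-cover : ∀ u v → Graph.Adj G u v → ∃[ z ] (u ∈ bag′ z × v ∈ bag′ z)
    edge-cover u v uv with local-edge u v uv | TreeDecomposition.edgeCover T u v uv
    ... | w , u-local , v-local | x , u∈x , v∈x =
      copy w x , ∈-bag′-copy⁺ u-local u∈x , ∈-bag′-copy⁺ v-local v∈x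
    occurrence : ∀ v → ∃[ z ] (v ∈ bag′ z)
    occurrence v with local-cover v | TreeDecomposition.nonEmptyOcc T v
    ... | w , v-local | x , v∈x = copy w x , ∈-bag′-copy⁺ v-local v∈x

  decomposition-bags : ∀ {q c} → ∣ X ∣ ≤ q → (∀ w x → ∣ bag x ∩ part w ∣ ≤ c) →
                       BagsAtMost decomposition (q + c)
  decomposition-bags {q} {c} ∣X∣≤q ∣local∣≤c zero    = ≤-trans ∣X∣≤q (m≤m+n q c)
  decomposition-bags {q} {c} ∣X∣≤q ∣local∣≤c (suc y) =
    ≤-trans (∣p∪q∣≤∣p∣+∣q∣ X _) (+-mono-≤ ∣X∣≤q (∣local∣≤c _ _))

-- Windows of a weak path decomposition

[m*n+o]/n≡m : ∀ m {n o} .{{_ : NonZero n}} → o < n → (m * n + o) / n ≡ m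
[m*n+o]/n≡m m {n} {o} o<n = begin
  (m * n + o) / n       ≡⟨ +-distrib-/-∣ˡ o (n∣m*n m) ⟩
  m * n / n + o / n     ≡⟨ cong₂ _+_ (m*n/n≡m m n) (m<n⇒m/n≡0 o<n) ⟩
  m + 0                 ≡⟨ +-identityʳ m ⟩
  m                     ∎
  where open ≡-Reasoning

-- Window w consists of the indices j with (j + D) / r ≡ w: at most one Selected index, which comes
-- first, and the a indices slot w 0, …, slot w (a - 1). In window 0 truncated subtraction turns the
-- slots before index 0 into the junk index 0, which still lies in window 0.
module Blocks (a D : ℕ) (D<r : D < suc a) where

  r : ℕ
  r = suc a

  window : ℕ → ℕ
  window j = (j + D) / r

  Selected : ℕ → Set
  Selected j = (j + D) % r ≡ 0

  slot : ℕ → ℕ → ℕ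
  slot w μ = w * r + suc μ ∸ D

  suc-split : ∀ j → suc (j + D) ≡ window j * r + suc ((j + D) % r)
  suc-split j = trans (cong suc (m≡m%n+[m/n]*n (j + D) r)) (+-comm (suc ((j + D) % r)) (window j * r))

  window-suc : ∀ j → window (suc j) ≡ window j ⊎ Selected (suc j)
  window-suc j with m≤n⇒m<n∨m≡n (m%n<n (j + D) r)
  ... | inj₁ ρ+1<r = inj₁ (trans (cong (_/ r) (suc-split j)) ([m*n+o]/n≡m (window j) ρ+1<r))
  ... | inj₂ ρ+1≡r = inj₂ (begin
    suc (j + D) % r              ≡⟨ cong (_% r) (suc-split j) ⟩
    (window j * r + suc _) % r   ≡⟨ cong (λ x → (window j * r + x) % r) ρ+1≡r ⟩
    (window j * r + r) % r       ≡⟨ cong (_% r) (+-comm (window j * r) r) ⟩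
    suc (window j) * r % r       ≡⟨ m*n%n≡0 (suc (window j)) r ⟩
    0                            ∎)
    where open ≡-Reasoning

  selected-between : ∀ {j} j′ → j ≤ j′ → window j < window j′ → ∃[ ℓ ] (j ≤ ℓ × ℓ ≤ j′ × Selected ℓ)
  selected-between zero     z≤n  w<w = contradiction w<w (<-irrefl refl)
  selected-between {j} (suc j′) j≤j′ w<w with m≤n⇒m<n∨m≡n j≤j′
  ... | inj₂ refl           = contradiction w<w (<-irrefl refl)
  ... | inj₁ (s≤s j≤j′-1) with window-suc j′
  ...   | inj₂ sel  = suc j′ , m≤n⇒m≤1+n j≤j′-1 , ≤-refl , sel
  ...   | inj₁ same with selected-between j′ j≤j′-1 (subst (window j <_) same w<w)
  ...     | ℓ , j≤ℓ , ℓ≤j′ , sel = ℓ , j≤ℓ , m≤n⇒m≤1+n ℓ≤j′ , sel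

  window-slot : ∀ w μ → μ < a → window (slot w μ) ≡ w
  window-slot w μ μ<a with D ≤? w * r + suc μ
  ... | yes D≤ = trans (cong (_/ r) (m∸n+n≡m D≤)) ([m*n+o]/n≡m w (s≤s μ<a))
  ... | no  D≰ = trans (cong window (m≤n⇒m∸n≡0 (<⇒≤ (≰⇒> D≰)))) (trans (m<n⇒m/n≡0 D<r) (sym w≡0))
    where
    w≡0 : w ≡ 0
    w≡0 = n<1⇒n≡0 (*-cancelʳ-< _ w 1 (begin-strict
      w * r           ≤⟨ m≤m+n (w * r) (suc μ) ⟩
      w * r + suc μ   <⟨ ≰⇒> D≰ ⟩
      D               <⟨ D<r ⟩
      r               ≡⟨ *-identityˡ r ⟨
      1 * r           ∎))
      where open ≤-Reasoning

  slot-window : ∀ j → ¬ Selected j → ∃[ μ ] (slot (window j) (toℕ {a} μ) ≡ j)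
  slot-window j unselected with (j + D) % r in ρ≡ | m%n<n (j + D) r
  ... | zero  | _       = contradiction refl unselected
  ... | suc μ | s≤s μ<a = fromℕ< μ<a , (begin
    window j * r + suc (toℕ (fromℕ< μ<a)) ∸ D  ≡⟨ cong (λ x → window j * r + suc x ∸ D) (Fin.toℕ-fromℕ< μ<a) ⟩
    window j * r + suc μ ∸ D                   ≡⟨ cong (λ x → window j * r + x ∸ D) ρ≡ ⟨
    window j * r + (j + D) % r ∸ D             ≡⟨ cong (_∸ D) (+-comm (window j * r) _) ⟩
    (j + D) % r + window j * r ∸ D             ≡⟨ cong (_∸ D) (m≡m%n+[m/n]*n (j + D) r) ⟨
    j + D ∸ D                                  ≡⟨ m+n∸n≡m j D ⟩
    j                                          ∎)
    where open ≡-Reasoning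

  window-mono : ∀ {j j′} → j ≤ j′ → window j ≤ window j′
  window-mono j≤j′ = /-monoˡ-≤ r (+-monoˡ-≤ D j≤j′)

  window-bound : ∀ {j t} → j < t → window j < t + r
  window-bound {j} j<t = ≤-<-trans (m/n≤m (j + D) r) (+-mono-< j<t D<r)

module _ {G : Graph} (𝒫 : WeakPathDecomposition G) where

  open Graph G using (n)
  open WeakPathDecomposition 𝒫 using (t; P; consecutive)

  magnitude-∑ : magnitude 𝒫 ≡ ∑[ i < t ] ∣ P i ∣
  magnitude-∑ = sum-map-tabulate (λ i → ∣ P i ∣) id

  extend-toℕ : ∀ i → extend P (toℕ i) ≡ P i
  extend-toℕ i with toℕ i <? t
  ... | yes i<t = cong P (Fin.fromℕ<-toℕ i i<t)
  ... | no  i≮t = contradiction (Fin.toℕ<n i) i≮t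

  ∈-extend⁻ : ∀ {v j} → v ∈ extend P j → ∃[ i ] (toℕ i ≡ j × v ∈ P i)
  ∈-extend⁻ {j = j} v∈ with j <? t
  ... | yes j<t = fromℕ< j<t , Fin.toℕ-fromℕ< j<t , v∈
  ... | no  _   = contradiction v∈ ∉⊥

  ∈-extend⁺ : ∀ {v} i → v ∈ P i → v ∈ extend P (toℕ i)
  ∈-extend⁺ i = subst (_ ∈_) (sym (extend-toℕ i))

  extend-consecutive : ∀ {v j j′ ℓ} → v ∈ extend P j → v ∈ extend P j′ → j ≤ ℓ → ℓ ≤ j′ → v ∈ extend P ℓ
  extend-consecutive {v} {ℓ = ℓ} v∈j v∈j′ j≤ℓ ℓ≤j′ with ∈-extend⁻ v∈j | ∈-extend⁻ v∈j′
  ... | i , refl , v∈i | i′ , refl , v∈i′ =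
    subst (λ x → v ∈ extend P x) toℕ-ℓ (∈-extend⁺ (fromℕ< ℓ<t) (consecutive v i i′ (fromℕ< ℓ<t) v∈i v∈i′
      (subst (toℕ i ≤_) (sym toℕ-ℓ) j≤ℓ) (subst (_≤ toℕ i′) (sym toℕ-ℓ) ℓ≤j′)))
    where
    ℓ<t : ℓ < t
    ℓ<t = ≤-<-trans ℓ≤j′ (Fin.toℕ<n i′)
    toℕ-ℓ : toℕ (fromℕ< ℓ<t) ≡ ℓ
    toℕ-ℓ = Fin.toℕ-fromℕ< ℓ<t

  ∣p∩extend∣≤ : ∀ {k} (p : Subset n) → (∀ i → ∣ p ∩ P i ∣ ≤ k) → ∀ j → ∣ p ∩ extend P j ∣ ≤ k
  ∣p∩extend∣≤ p bound j with j <? t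
  ... | yes j<t = bound (fromℕ< j<t)
  ... | no  _   = ≤-trans (∣p∩q∣≤∣q∣ p ⊥) (≤-trans (≤-reflexive (∣⊥∣≡0 n)) z≤n)

module Windows {G : Graph} (𝒫 : WeakPathDecomposition G) (a D : ℕ) (D<r : D < suc a) where

  open Graph G using (n)
  open WeakPathDecomposition 𝒫 using (t; P)
  open Blocks a D D<r

  ext : ℕ → Subset n
  ext = extend P

  selected : Fin t → Subset n
  selected i = atZero ((toℕ i + D) % r) (P i)

  separator : Subset n
  separator = ⋃ (tabulate selected)

  slots : Fin (t + r) → Fin a → Subset n
  slots w μ = ext (slot (toℕ w) (toℕ μ))

  part : Fin (t + r) → Subset n
  part w = ⋃ (tabulate (slots w))

  window-of : (i : Fin t) → Fin (t + r)
  window-of i = fromℕ< (window-bound (Fin.toℕ<n i))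

  toℕ-window-of : ∀ i → toℕ (window-of i) ≡ window (toℕ i)
  toℕ-window-of i = Fin.toℕ-fromℕ< _

  ∈-separator : ∀ {v ℓ} → v ∈ ext ℓ → Selected ℓ → v ∈ separator
  ∈-separator {v} v∈ℓ sel with ∈-extend⁻ 𝒫 v∈ℓ
  ... | i , refl , v∈i = x∈⋃tabulate⁺ selected i (subst (λ ρ → v ∈ atZero ρ (P i)) (sym sel) v∈i)

  same-window-≤ : ∀ {v j j′} → v ∉ separator → v ∈ ext j → v ∈ ext j′ → j ≤ j′ → window j ≡ window j′
  same-window-≤ v∉X v∈j v∈j′ j≤j′ with m≤n⇒m<n∨m≡n (window-mono j≤j′)
  ... | inj₂ same = same
  ... | inj₁ jump with selected-between _ j≤j′ jump
  ...   | ℓ , j≤ℓ , ℓ≤j′ , sel =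
    contradiction (∈-separator (extend-consecutive 𝒫 v∈j v∈j′ j≤ℓ ℓ≤j′) sel) v∉X

  same-window : ∀ {v j j′} → v ∉ separator → v ∈ ext j → v ∈ ext j′ → window j ≡ window j′
  same-window {j = j} {j′} v∉X v∈j v∈j′ with ≤-total j j′
  ... | inj₁ j≤j′ = same-window-≤ v∉X v∈j v∈j′ j≤j′
  ... | inj₂ j′≤j = sym (same-window-≤ v∉X v∈j′ v∈j j′≤j)

  ∈-part⁺ : ∀ {v j} w → v ∉ separator → v ∈ ext j → toℕ w ≡ window j → v ∈ part w
  ∈-part⁺ {v} {j} w v∉X v∈j w≡ with slot-window j (λ sel → v∉X (∈-separator v∈j sel))
  ... | μ , slot≡j = x∈⋃tabulate⁺ (slots w) μ
    (subst (λ x → v ∈ ext x) (sym (trans (cong (λ x → slot x (toℕ μ)) w≡) slot≡j)) v∈j)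

  ∈-part⁻ : ∀ {v} w → v ∈ part w → ∃[ j ] (v ∈ ext j × window j ≡ toℕ w)
  ∈-part⁻ w v∈w with x∈⋃tabulate⁻ (slots w) v∈w
  ... | μ , v∈slot = _ , v∈slot , window-slot (toℕ w) (toℕ μ) (Fin.toℕ<n μ)

  local : ∀ {v j} w → v ∈ ext j → toℕ w ≡ window j → v ∈ separator ⊎ v ∈ part w
  local {v} w v∈j w≡ with v ∈? separator
  ... | yes v∈X = inj₁ v∈X
  ... | no  v∉X = inj₂ (∈-part⁺ w v∉X v∈j w≡)

  local-near : ∀ {v} i → v ∈ P i ∪ ext (suc (toℕ i)) → v ∈ separator ⊎ v ∈ part (window-of i)
  local-near {v} i v∈ with x∈p∪q⁻ (P i) _ v∈ | window-suc (toℕ i)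
  ... | inj₁ v∈i    | _          = local (window-of i) (∈-extend⁺ 𝒫 i v∈i) (toℕ-window-of i)
  ... | inj₂ v∈next | inj₁ same  = local (window-of i) v∈next (trans (toℕ-window-of i) (sym same))
  ... | inj₂ v∈next | inj₂ sel   = inj₁ (∈-separator v∈next sel)

  local-cover : ∀ v → ∃[ w ] (v ∈ separator ⊎ v ∈ part w)
  local-cover v with WeakPathDecomposition.cover 𝒫 v
  ... | i , v∈i = window-of i , local (window-of i) (∈-extend⁺ 𝒫 i v∈i) (toℕ-window-of i)

  local-edge : ∀ u v → Graph.Adj G u v →
               ∃[ w ] ((u ∈ separator ⊎ u ∈ part w) × (v ∈ separator ⊎ v ∈ part w))
  local-edge u v uv with WeakPathDecomposition.edgeCover 𝒫 u v uv
  ... | i , u∈ , v∈ = window-of i , local-near i u∈ , local-near i v∈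

  part-unique : ∀ {v w w′} → v ∉ separator → v ∈ part w → v ∈ part w′ → w ≡ w′
  part-unique {w = w} {w′} v∉X v∈w v∈w′ with ∈-part⁻ w v∈w | ∈-part⁻ w′ v∈w′
  ... | j , v∈j , j≡w | j′ , v∈j′ , j′≡w′ =
    Fin.toℕ-injective (trans (sym j≡w) (trans (same-window v∉X v∈j v∈j′) j′≡w′))

  ∣separator∣≤ : ∣ separator ∣ ≤ residue-class-size a D P
  ∣separator∣≤ = ∣⋃tabulate∣≤∑ selected

  ∣p∩part∣≤ : ∀ {k} (p : Subset n) → (∀ j → ∣ p ∩ ext j ∣ ≤ k) → ∀ w → ∣ p ∩ part w ∣ ≤ a * k
  ∣p∩part∣≤ {k} p bound w =
    ≤-trans (∣p∩⋃tabulate∣≤∑ p (slots w))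
            (∑-≤-* k (λ μ → ∣ p ∩ slots w μ ∣) (bound ∘ slot (toℕ w) ∘ toℕ))

orthogonal-0⇒empty-bags : ∀ {G} (T : TreeDecomposition G) (P : WeakPathDecomposition G) →
                          Orthogonal 0 T P → BagsAtMost T 0
orthogonal-0⇒empty-bags {G} T P orth x =
  ≤-reflexive (trans (cong ∣_∣ (Empty-unique no-vertex)) (∣⊥∣≡0 (Graph.n G)))
  where
  no-vertex : Empty (TreeDecomposition.bag T x)
  no-vertex (v , v∈x) with WeakPathDecomposition.cover P v
  ... | i , v∈i = contradiction (≤-trans (x∈p⇒0<∣p∣ (x∈p∩q⁺ (v∈x , v∈i))) (orth x i)) λ ()

lemma11 : (G : Graph) (T : TreeDecomposition G) (P : WeakPathDecomposition G)
          (k s : ℕ) → Orthogonal k T P → magnitude P ≡ s →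
          ∃[ D ] ∃[ b ] (BagsAtMost {G} D b × b * b ≤ 4 * k * s)
lemma11 G T P zero    s orth _    = T , 0 , orthogonal-0⇒empty-bags T P orth , z≤n
lemma11 G T P k@(suc _) _ orth refl with ∃-sqrt-bracket k (magnitude P)
... | a , lo , hi with ∃-light-residue-class a (WeakPathDecomposition.P P)
... | D , D<r , light =
  Glued.decomposition , q + a * k ,
  Glued.decomposition-bags ∣separator∣≤ (λ w x → ∣p∩part∣≤ (bag x) (∣p∩extend∣≤ P (bag x) (orth x)) w) ,
  [q+ak]²≤4ks a k (magnitude P) q lo hi (≤-trans light (≤-reflexive (sym (magnitude-∑ P))))
  where
  open Windows P a D D<r
  open TreeDecomposition T using (bag)
  q : ℕ
  q = residue-class-size a D (WeakPathDecomposition.P P)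
  module Glued = Glue T (WeakPathDecomposition.t P + suc a) separator part local-cover local-edge part-unique
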